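{- Let $S[1\mathinner{.\,.}n]$ have a (valid) bidirectional parse with $b$ phrases, and let $h_q$ denote the height of $S[q]$ in this parse. For any integer $\alpha>1$, one can build an $\alpha$-contracting bidirectional parse of $S$ with $O(b\log_\alpha(n/b))$ phrases such that, for every $q$, the height $h'_q$ of $S[q]$ in the new parse satisfies $h'_q\le h_q$.
   Context: A parse cuts $S$ into consecutive substrings (phrases) $S=B_1\cdots B_t$, phrase $B_i$ starting at position $x_i$. Each phrase is either explicit (stored literally, of length $O(\log_\sigma n)$ with $\sigma$ the alphabet size) or a copy of another substring $S[p_i\mathinner{.\,.}p_i+|B_i|-1]=B_i$, its source; sources may lie anywhere in $S$ (bidirectional parse). Define $f(q)=q$ if $q$ lies in an explicit phrase, and $f(q)=p_i+q-x_i$ if $q$ lies in non-explicit phrase $B_i$. The parse is valid if iterating $f$ from any $q$ eventually reaches a position in an explicit phrase; the height $h_q$ is the number of applications of $f$ needed. A parse is $\alpha$-contracting if no source overlaps a phrase that is strictly more than $\alpha$ times longer than the source. Convention: $\log_b x$ denotes $\max(1,\log_b x)$. -}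

module Defs where

open import Data.Nat using (ℕ; zero; suc; _+_; _*_; _∸_; _^_; _≤_; _<_; _<?_; _⊔_)
open import Data.Nat.Properties using ()
open import Data.List using (List; []; _∷_; length; map)
open import Data.Nat.ListAction using (sum)
open import Data.List.Relation.Unary.All using (All)
open import Data.List.Membership.Propositional using (_∈_)
open import Data.Vec using (Vec; []; _∷_)
open import Data.Maybe using (Maybe; just; nothing)
open import Data.Product using (_×_; _,_; ∃)
open import Relation.Nullary using (yes; no)
open import Relation.Binary.PropositionalEquality using (_≡_)

-- Positions are 0-based natural numbers: S[0 .. n-1].

charAt : ∀ {A : Set} {n : ℕ} → Vec A n → ℕ → Maybe A
charAt []       _       = nothing
charAt (a ∷ as) zero    = just a
charAt (a ∷ as) (suc i) = charAt as i

-- A phrase: explicit (stored literally) of a given length,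
-- or a copy of a given length whose source starts at a given position.
data Phrase : Set where
  explicit : (ℓ : ℕ) → Phrase
  copy     : (ℓ : ℕ) → (p : ℕ) → Phrase

len : Phrase → ℕ
len (explicit ℓ) = ℓ
len (copy ℓ p)   = ℓ

positioned : ℕ → List Phrase → List (ℕ × Phrase)
positioned x []       = []
positioned x (b ∷ bs) = (x , b) ∷ positioned (x + len b) bs

locate : List Phrase → ℕ → Maybe (ℕ × Phrase)
locate []       q = nothing
locate (b ∷ bs) q with q <? len b
... | yes _ = just (q , b)
... | no  _ = locate bs (q ∸ len b)

-- Height P q h : iterating f from q reaches a position in an explicit
-- phrase after exactly h applications (f(q) = p_i + q - x_i in copy phrases).
data Height (P : List Phrase) : ℕ → ℕ → Set where
  here : ∀ {q k ℓ} → locate P q ≡ just (k , explicit ℓ) → Height P q 0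
  step : ∀ {q k ℓ p h} → locate P q ≡ just (k , copy ℓ p) →
         Height P (p + k) h → Height P q (suc h)

GoodPhrase : ∀ {A : Set} {n : ℕ} → Vec A n → ℕ → ℕ × Phrase → Set
GoodPhrase {n = n} S L (x , explicit ℓ) = 1 ≤ ℓ × ℓ ≤ L
GoodPhrase {n = n} S L (x , copy ℓ p)   =
  1 ≤ ℓ × p + ℓ ≤ n × (∀ k → k < ℓ → charAt S (p + k) ≡ charAt S (x + k))

IsParse : ∀ {A : Set} {n : ℕ} → Vec A n → ℕ → List Phrase → Set
IsParse {n = n} S L P =
  sum (map len P) ≡ n ×
  All (GoodPhrase S L) (positioned 0 P) ×
  (∀ q → q < n → ∃ λ h → Height P q h)

Overlap : ℕ → ℕ → ℕ → ℕ → Set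
Overlap a ℓ c m = a < c + m × c < a + ℓ

Contracting : ℕ → List Phrase → Set
Contracting α P =
  ∀ {x ℓ p y} (b : Phrase) →
  (x , copy ℓ p) ∈ positioned 0 P → (y , b) ∈ positioned 0 P →
  Overlap p ℓ y (len b) → len b ≤ α * ℓ

-- Every phrase of P is cut into pieces whose lengths grow by a factor α from both ends
-- towards the middle, so a piece is at most α (1 + d) long, d being its distance to the
-- nearer end of its phrase, and a phrase of length m gets about 2 log_α m pieces
-- (at most m / α^k + 2 (k + 1) of them, for every k).  A piece [y, y + ℓ) of a copy phrase
-- is pushed through f as a block until its source [s, s + ℓ) overlaps no piece longer than
-- α ℓ, and is stored explicitly if an explicit phrase is reached first.  A piece longer than
-- α ℓ that overlaps [s, s + ℓ) lies at distance at least ℓ from both ends of its phrase, so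
-- while the source does not fit it stays inside one old phrase, f moves it rigidly, and
-- every step lowers the heights: heights never grow.  With n ≤ b α^k the pieces number at
-- most (3 + 2k) b.

module Submission where

open import Defs
open import Data.Nat using (ℕ; zero; suc; _+_; _*_; _∸_; _^_; _≤_; _<_; _⊔_; z≤n; s≤s; _≤?_; _<?_; s≤s⁻¹; >-nonZero)
open import Data.Nat.Properties
open import Data.Nat.ListAction using (sum)
open import Data.Nat.ListAction.Properties using (sum-++)
open import Data.Nat.Tactic.RingSolver using (solve-∀)
open import Data.Nat.Induction using (<-rec)
open import Data.Vec using (Vec)
open import Function using (_∘_)
open import Data.List using (List; []; _∷_; _++_; length; map; concatMap)
open import Data.List.Properties using (length-++; length-map)
open import Data.List.Relation.Unary.All as All using (All; []; _∷_)
open import Data.List.Relation.Unary.All.Properties using (++⁺; ¬All⇒Any¬)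
open import Data.List.Relation.Unary.Any using (here; there)
open import Data.List.Membership.Propositional using (_∈_; find)
open import Data.List.Membership.Propositional.Properties using (∈-++⁻; ∈-map⁻)
open import Data.Product using (Σ; ∃; ∃₂; _×_; _,_; proj₁; proj₂; <_,_>)
open import Data.Sum using (_⊎_; inj₁; inj₂)
open import Relation.Nullary using (¬_; Dec; yes; no; contradiction)
open import Relation.Nullary.Decidable using (_×-dec_; _→-dec_)
open import Data.Maybe using (just)
open import Relation.Binary.PropositionalEquality using (_≡_; refl; sym; trans; cong; cong₂; subst; subst₂; module ≡-Reasoning)

overlap⇒within : ∀ α {s ℓ x o m c} → Overlap s ℓ (x + o) m → α * ℓ < m →
                 m ≤ α * suc o → m ≤ α * suc c → x ≤ s × s + ℓ ≤ x + o + m + c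
overlap⇒within α {s} {ℓ} {x} {o} {m} {c} (s<end , start<) αℓ<m m≤o m≤c =
  <⇒≤ (+-cancelʳ-< ℓ x s x+ℓ<s+ℓ) , s+ℓ≤end
  where
  ℓ≤o : ℓ ≤ o
  ℓ≤o = s≤s⁻¹ (*-cancelˡ-< α ℓ (suc o) (<-≤-trans αℓ<m m≤o))
  ℓ≤c : ℓ ≤ c
  ℓ≤c = s≤s⁻¹ (*-cancelˡ-< α ℓ (suc c) (<-≤-trans αℓ<m m≤c))
  x+ℓ<s+ℓ : x + ℓ < s + ℓ
  x+ℓ<s+ℓ = ≤-<-trans (+-monoʳ-≤ x ℓ≤o) start<
  s+ℓ≤end : s + ℓ ≤ x + o + m + c
  s+ℓ≤end = ≤-trans (+-monoʳ-≤ s ℓ≤c) (<⇒≤ (+-monoˡ-< c s<end))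

1+2*[1+k]≤5*[1⊔k] : ∀ k → 1 + 2 * suc k ≤ 5 * (1 ⊔ k)
1+2*[1+k]≤5*[1⊔k] zero    = s≤s (s≤s (s≤s z≤n))
1+2*[1+k]≤5*[1⊔k] (suc k) =
  subst₂ _≤_ (expandˡ k) (expandʳ k) (+-monoʳ-≤ 5 (*-monoˡ-≤ k (m≤m+n 2 3)))
  where
  expandˡ : ∀ k → 5 + 2 * k ≡ 1 + 2 * suc (suc k)
  expandˡ = solve-∀
  expandʳ : ∀ k → 5 + 5 * k ≡ 5 * suc k
  expandʳ = solve-∀

spans : ℕ → List ℕ → List (ℕ × ℕ)
spans x []       = []
spans x (ℓ ∷ ls) = (x , ℓ) ∷ spans (x + ℓ) ls

spans-++ : ∀ x ls ms → spans x (ls ++ ms) ≡ spans x ls ++ spans (x + sum ls) ms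
spans-++ x []       ms = cong (λ z → spans z ms) (sym (+-identityʳ x))
spans-++ x (ℓ ∷ ls) ms = cong ((x , ℓ) ∷_)
  (trans (spans-++ (x + ℓ) ls ms) (cong (λ z → spans (x + ℓ) ls ++ spans z ms) (+-assoc x ℓ (sum ls))))

data Trim (G : ℕ) : ℕ → Set where
  none : Trim G 0
  one  : ∀ r → 1 ≤ r → r ≤ G → Trim G r
  two  : ∀ r → 1 ≤ r → r ≤ G → Trim G (G + r)
  peel : ∀ r → Trim G (G + (r + G))

trim : ∀ G r → Trim G r
trim G zero = none
trim G (suc r) with suc r ≤? G
... | yes r≤G = one (suc r) (s≤s z≤n) r≤G
... | no r≰G with suc r ≤? G + G
...   | yes r≤2G = subst (Trim G) (m+[n∸m]≡n (<⇒≤ G<r)) (two (suc r ∸ G) (m<n⇒0<n∸m G<r) r∸G≤G)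
  where
  G<r : G < suc r
  G<r = ≰⇒> r≰G
  r∸G≤G : suc r ∸ G ≤ G
  r∸G≤G = subst (suc r ∸ G ≤_) (m+n∸n≡m G G) (∸-monoˡ-≤ G r≤2G)
...   | no r≰2G = subst (Trim G) G+[d+G]≡r (peel d)
  where
  d = suc r ∸ (G + G)
  G+[d+G]≡r : G + (d + G) ≡ suc r
  G+[d+G]≡r = trans (trans (+-comm G (d + G)) (+-assoc d G G)) (m∸n+n≡m (<⇒≤ (≰⇒> r≰2G)))

module Split (α : ℕ) (1≤α : 1 ≤ α) where

  stride : ℕ → ℕ
  stride a = α * suc a

  split : (fuel a r : ℕ) → List ℕ
  split zero    a r = []
  split (suc f) a r with trim (stride a) r
  ... | none      = []
  ... | one r _ _ = r ∷ []
  ... | two r _ _ = stride a ∷ r ∷ []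
  ... | peel r    = stride a ∷ split f (a + stride a) r ++ stride a ∷ []

  pieces : ℕ → List ℕ
  pieces m = split m 0 m

  1≤stride : ∀ a → 1 ≤ stride a
  1≤stride a = ≤-trans 1≤α (m≤m*n α (suc a))

  stride≤stride-+ : ∀ a b → stride a ≤ stride (a + b)
  stride≤stride-+ a b = *-monoʳ-≤ α (s≤s (m≤m+n a b))

  peel-fuel : ∀ {a r f} → stride a + (r + stride a) ≤ suc f → r ≤ f
  peel-fuel {a} {r} le = s≤s⁻¹ (≤-trans (m<m+n r (1≤stride a)) (≤-trans (m≤n+m (r + stride a) (stride a)) le))

  sum-split : ∀ f a r → r ≤ f → sum (split f a r) ≡ r
  sum-split zero    a zero le = refl
  sum-split (suc f) a r  le with trim (stride a) r
  ... | none        = refl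
  ... | one r′ _ _  = +-identityʳ r′
  ... | two r′ _ _  = cong (stride a +_) (+-identityʳ r′)
  ... | peel r′     = begin
    stride a + sum (split f (a + stride a) r′ ++ stride a ∷ [])
      ≡⟨ cong (stride a +_) (sum-++ (split f (a + stride a) r′) (stride a ∷ [])) ⟩
    stride a + (sum (split f (a + stride a) r′) + (stride a + 0))
      ≡⟨ cong₂ (λ u v → stride a + (u + v)) (sum-split f (a + stride a) r′ (peel-fuel le)) (+-identityʳ (stride a)) ⟩
    stride a + (r′ + stride a) ∎
    where open ≡-Reasoning

  -- The piece (y , m) of the segment [x , x + r) is nonempty and at most α (1 + a + d) long,
  -- d being its distance to each end of the segment; a is how much has already been
  -- trimmed from each side of the enclosing phrase.
  Tapered : ℕ → ℕ → ℕ → ℕ × ℕ → Set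
  Tapered a x r (y , m) =
    ∃₂ λ o c → y ≡ x + o × o + m + c ≡ r × 1 ≤ m × m ≤ stride (a + o) × m ≤ stride (a + c)

  tapered-inner : ∀ {a x r G} {piece : ℕ × ℕ} → Tapered (a + G) (x + G) r piece →
                  Tapered a x (G + (r + G)) piece
  tapered-inner {a} {x} {r} {G} {y , m} (o , c , y≡ , o+m+c≡r , 1≤m , m≤o , m≤c) =
    G + o , c + G , trans y≡ (+-assoc x G o) ,
    trans (shuffle G o m c) (cong (λ z → G + (z + G)) o+m+c≡r) , 1≤m ,
    subst (λ z → m ≤ stride z) (+-assoc a G o) m≤o ,
    subst (λ z → m ≤ stride z) (trans (+-assoc a G c) (cong (a +_) (+-comm G c))) m≤c
    where
    shuffle : ∀ G o m c → G + o + m + (c + G) ≡ G + (o + m + c + G)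
    shuffle = solve-∀

  tapered-split : ∀ f a x r → r ≤ f → All (Tapered a x r) (spans x (split f a r))
  tapered-split zero    a x zero le = []
  tapered-split (suc f) a x r  le with trim (stride a) r
  ... | none       = []
  ... | one r′ 1≤r r≤G =
    (0 , 0 , sym (+-identityʳ x) , +-identityʳ r′ , 1≤r ,
     ≤-trans r≤G (stride≤stride-+ a 0) , ≤-trans r≤G (stride≤stride-+ a 0)) ∷ []
  ... | two r′ 1≤r r≤G =
    (0 , r′ , sym (+-identityʳ x) , refl , 1≤stride a , stride≤stride-+ a 0 , stride≤stride-+ a r′) ∷
    (stride a , 0 , refl , +-identityʳ _ , 1≤r ,
     ≤-trans r≤G (stride≤stride-+ a _) , ≤-trans r≤G (stride≤stride-+ a 0)) ∷ []
  ... | peel r′ = first ∷ subst (All (Tapered a x _)) (sym (spans-++ (x + G) inner (G ∷ [])))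
                            (++⁺ (All.map tapered-inner (tapered-split f (a + G) (x + G) r′ (peel-fuel le)))
                                 (last ∷ []))
    where
    G = stride a
    inner = split f (a + G) r′
    first : Tapered a x (G + (r′ + G)) (x , G)
    first = 0 , r′ + G , sym (+-identityʳ x) , refl , 1≤stride a , stride≤stride-+ a 0 , stride≤stride-+ a _
    last : Tapered a x (G + (r′ + G)) (x + G + sum inner , G)
    last = G + r′ , 0 ,
      trans (cong (x + G +_) (sum-split f (a + G) r′ (peel-fuel le))) (+-assoc x G r′) ,
      trans (+-identityʳ _) (+-assoc G r′ G) , 1≤stride a , stride≤stride-+ a _ , stride≤stride-+ a 0

  few-pieces : ∀ {ℓ} j r K → ℓ ≤ 2 → K * ℓ ≤ r + 2 * suc j * K
  few-pieces {ℓ} j r K ℓ≤2 = begin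
    K * ℓ             ≤⟨ *-monoʳ-≤ K ℓ≤2 ⟩
    K * 2             ≡⟨ *-comm K 2 ⟩
    2 * K             ≤⟨ *-monoˡ-≤ K (*-monoʳ-≤ 2 (s≤s (z≤n {j}))) ⟩
    2 * suc j * K     ≤⟨ m≤n+m _ r ⟩
    r + 2 * suc j * K ∎
    where open ≤-Reasoning

  *-length-peel : ∀ K G (inner : List ℕ) → K * length (G ∷ inner ++ G ∷ []) ≡ 2 * K + K * length inner
  *-length-peel K G inner = trans (cong (λ l → K * suc l) (length-++ inner)) (expand K (length inner))
    where
    expand : ∀ K l → K * suc (l + 1) ≡ 2 * K + K * l
    expand = solve-∀

  length-split-≤ : ∀ j f a r {K} → r ≤ f → K ≤ α ^ j * stride a →
                   K * length (split f a r) ≤ r + 2 * suc j * K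
  length-split-≤ j zero a zero {K} le K≤ = few-pieces j 0 K z≤n
  length-split-≤ j (suc f) a r {K} le K≤ with trim (stride a) r
  ... | none       = few-pieces j 0 K z≤n
  ... | one r′ _ _ = few-pieces j r′ K (s≤s z≤n)
  ... | two r′ _ _ = few-pieces j (stride a + r′) K ≤-refl
  length-split-≤ zero (suc f) a ._ {K} le K≤ | peel r′ = begin
    K * length (G ∷ inner ++ G ∷ [])  ≡⟨ *-length-peel K G inner ⟩
    2 * K + K * length inner          ≤⟨ +-monoʳ-≤ (2 * K) (length-split-≤ 0 f (a + G) r′ (peel-fuel le) K≤′) ⟩
    2 * K + (r′ + 2 * 1 * K)          ≡⟨ regroup K r′ ⟩
    K + (r′ + K) + 2 * 1 * K          ≤⟨ +-monoˡ-≤ (2 * 1 * K) (+-mono-≤ K≤G (+-monoʳ-≤ r′ K≤G)) ⟩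
    G + (r′ + G) + 2 * 1 * K          ∎
    where
    open ≤-Reasoning
    G = stride a
    inner = split f (a + G) r′
    K≤G : K ≤ G
    K≤G = subst (K ≤_) (*-identityˡ G) K≤
    K≤′ : K ≤ α ^ 0 * stride (a + G)
    K≤′ = ≤-trans K≤ (*-monoʳ-≤ 1 (stride≤stride-+ a G))
    regroup : ∀ K r → 2 * K + (r + 2 * 1 * K) ≡ K + (r + K) + 2 * 1 * K
    regroup = solve-∀
  length-split-≤ (suc j) (suc f) a ._ {K} le K≤ | peel r′ = begin
    K * length (G ∷ inner ++ G ∷ [])  ≡⟨ *-length-peel K G inner ⟩
    2 * K + K * length inner          ≤⟨ +-monoʳ-≤ (2 * K) (length-split-≤ j f (a + G) r′ (peel-fuel le) K≤′) ⟩
    2 * K + (r′ + 2 * suc j * K)      ≡⟨ regroup K r′ j ⟩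
    r′ + 2 * suc (suc j) * K          ≤⟨ +-monoˡ-≤ _ (≤-trans (m≤n+m r′ G) (m≤m+n (G + r′) G)) ⟩
    G + r′ + G + 2 * suc (suc j) * K  ≡⟨ cong (_+ 2 * suc (suc j) * K) (+-assoc G r′ G) ⟩
    G + (r′ + G) + 2 * suc (suc j) * K ∎
    where
    open ≤-Reasoning
    G = stride a
    inner = split f (a + G) r′
    αG≤ : α * G ≤ stride (a + G)
    αG≤ = *-monoʳ-≤ α (≤-trans (m≤n+m G a) (n≤1+n (a + G)))
    K≤′ : K ≤ α ^ j * stride (a + G)
    K≤′ = ≤-trans K≤ (≤-trans (≤-reflexive (reassoc α (α ^ j) G)) (*-monoʳ-≤ (α ^ j) αG≤))
      where
      reassoc : ∀ x y z → x * y * z ≡ y * (x * z)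
      reassoc = solve-∀
    regroup : ∀ K r j → 2 * K + (r + 2 * suc j * K) ≡ r + 2 * suc (suc j) * K
    regroup = solve-∀

  sum-pieces : ∀ m → sum (pieces m) ≡ m
  sum-pieces m = sum-split m 0 m ≤-refl

  tapered-pieces : ∀ x m → All (Tapered 0 x m) (spans x (pieces m))
  tapered-pieces x m = tapered-split m 0 x m ≤-refl

  length-pieces-≤ : ∀ k m → α ^ k * length (pieces m) ≤ m + 2 * suc k * α ^ k
  length-pieces-≤ k m =
    length-split-≤ k m 0 m ≤-refl (m≤m*n (α ^ k) (stride 0) {{>-nonZero (1≤stride 0)}})

length-concatMap-≤ : ∀ {X Y : Set} (g : X → List Y) (w : X → ℕ) K c →
                     (∀ x → K * length (g x) ≤ w x + c) →
                     ∀ xs → K * length (concatMap g xs) ≤ sum (map w xs) + length xs * c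
length-concatMap-≤ g w K c bound []       = ≤-reflexive (*-zeroʳ K)
length-concatMap-≤ g w K c bound (x ∷ xs) = begin
  K * length (g x ++ concatMap g xs)                    ≡⟨ cong (K *_) (length-++ (g x)) ⟩
  K * (length (g x) + length (concatMap g xs))          ≡⟨ *-distribˡ-+ K (length (g x)) _ ⟩
  K * length (g x) + K * length (concatMap g xs)        ≤⟨ +-mono-≤ (bound x) (length-concatMap-≤ g w K c bound xs) ⟩
  w x + c + (sum (map w xs) + length xs * c)            ≡⟨ regroup (w x) c (sum (map w xs)) (length xs) ⟩
  w x + sum (map w xs) + suc (length xs) * c            ∎
  where
  open ≤-Reasoning
  regroup : ∀ u c s l → u + c + (s + l * c) ≡ u + s + suc l * c
  regroup = solve-∀

module _ (g : Phrase → List ℕ) (sum-g : ∀ B → sum (g B) ≡ len B) where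

  sum-concatMap : ∀ Q → sum (concatMap g Q) ≡ sum (map len Q)
  sum-concatMap []      = refl
  sum-concatMap (B ∷ Q) = trans (sum-++ (g B) (concatMap g Q)) (cong₂ _+_ (sum-g B) (sum-concatMap Q))

  ∈-spans-concatMap : ∀ x Q {c} → c ∈ spans x (concatMap g Q) →
                      ∃₂ λ y B → (y , B) ∈ positioned x Q × c ∈ spans y (g B)
  ∈-spans-concatMap x (B ∷ Q) c∈ rewrite spans-++ x (g B) (concatMap g Q) | sum-g B
    with ∈-++⁻ (spans x (g B)) c∈
  ... | inj₁ c∈B = x , B , here refl , c∈B
  ... | inj₂ c∈Q = let y , B′ , yB′∈ , c∈B′ = ∈-spans-concatMap (x + len B) Q c∈Q
                   in y , B′ , there yB′∈ , c∈B′

locate-< : ∀ b Q q → q < len b → locate (b ∷ Q) q ≡ just (q , b)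
locate-< b Q q q< with q <? len b
... | yes _  = refl
... | no q≮ = contradiction q< q≮

locate-≥ : ∀ b Q q → ¬ q < len b → locate (b ∷ Q) q ≡ locate Q (q ∸ len b)
locate-≥ b Q q q≮ with q <? len b
... | yes q< = contradiction q< q≮
... | no _   = refl

positioned-offset : ∀ x Q {y B} → (y , B) ∈ positioned x Q →
                    ∃ λ d → y ≡ x + d × ∀ j → j < len B → locate Q (d + j) ≡ just (j , B)
positioned-offset x (b ∷ Q) (here refl) = 0 , sym (+-identityʳ x) , λ j j< → locate-< b Q j j<
positioned-offset x (b ∷ Q) {B = B} (there yB∈) =
  let d , y≡ , loc = positioned-offset (x + len b) Q yB∈
  in len b + d , trans y≡ (+-assoc x (len b) d) , λ j j< → begin
    locate (b ∷ Q) (len b + d + j)        ≡⟨ locate-≥ b Q _ (≤⇒≯ (≤-trans (m≤m+n (len b) d) (m≤m+n _ j))) ⟩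
    locate Q (len b + d + j ∸ len b)      ≡⟨ cong (λ z → locate Q (z ∸ len b)) (+-assoc (len b) d j) ⟩
    locate Q (len b + (d + j) ∸ len b)    ≡⟨ cong (locate Q) (m+n∸m≡n (len b) (d + j)) ⟩
    locate Q (d + j)                      ≡⟨ loc j j< ⟩
    just (j , B) ∎
  where open ≡-Reasoning

locate-positioned : ∀ Q {y B} → (y , B) ∈ positioned 0 Q →
                    ∀ j → j < len B → locate Q (y + j) ≡ just (j , B)
locate-positioned Q yB∈ with positioned-offset 0 Q yB∈
... | d , refl , loc = loc

positioned-bound : ∀ x Q {y B} → (y , B) ∈ positioned x Q → y + len B ≤ x + sum (map len Q)
positioned-bound x (b ∷ Q) (here refl) = +-monoʳ-≤ x (m≤m+n (len b) _)
positioned-bound x (b ∷ Q) (there yB∈) =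
  ≤-trans (positioned-bound (x + len b) Q yB∈) (≤-reflexive (+-assoc x (len b) _))

height-unique : ∀ {Q q h₁ h₂} → Height Q q h₁ → Height Q q h₂ → h₁ ≡ h₂
height-unique (here e)   (here e′) = refl
height-unique (here e)   (step e′ d′) with trans (sym e) e′
... | ()
height-unique (step e d) (here e′) with trans (sym e) e′
... | ()
height-unique (step e d) (step e′ d′) with trans (sym e) e′
... | refl = cong suc (height-unique d d′)

height-copy : ∀ {Q q h k m p} → locate Q q ≡ just (k , copy m p) → Height Q q h →
              ∃ λ h′ → h ≡ suc h′ × Height Q (p + k) h′
height-copy e (here e′) with trans (sym e) e′
... | ()
height-copy e (step e′ d) with trans (sym e) e′
... | refl = _ , refl , d

module Tiling (f : ℕ × ℕ → Phrase) (len-f : ∀ c → len (f c) ≡ proj₂ c) where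

  map-len-tiling : ∀ x ls → map len (map f (spans x ls)) ≡ ls
  map-len-tiling x []       = refl
  map-len-tiling x (ℓ ∷ ls) = cong₂ _∷_ (len-f (x , ℓ)) (map-len-tiling (x + ℓ) ls)

  positioned-tiling : ∀ x ls → positioned x (map f (spans x ls)) ≡ map < proj₁ , f > (spans x ls)
  positioned-tiling x []       = refl
  positioned-tiling x (ℓ ∷ ls) = cong ((x , f (x , ℓ)) ∷_)
    (trans (cong (λ z → positioned (x + z) (map f (spans (x + ℓ) ls))) (len-f (x , ℓ)))
           (positioned-tiling (x + ℓ) ls))

  locate-tiling : ∀ x ls q → q < sum ls →
                  ∃₂ λ y ℓ → ∃ λ t → (y , ℓ) ∈ spans x ls × y + t ≡ x + q × t < ℓ ×
                                     locate (map f (spans x ls)) q ≡ just (t , f (y , ℓ))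
  locate-tiling x (ℓ ∷ ls) q q< with q <? ℓ
  ... | yes q<ℓ = x , ℓ , q , here refl , refl , q<ℓ ,
                  locate-< (f (x , ℓ)) _ q (subst (q <_) (sym (len-f (x , ℓ))) q<ℓ)
  ... | no q≮ℓ =
    let ℓ≤q = ≮⇒≥ q≮ℓ
        y , ℓ′ , t , yℓ′∈ , y+t≡ , t< , loc =
          locate-tiling (x + ℓ) ls (q ∸ ℓ) (+-cancelˡ-< ℓ _ _ (subst (_< ℓ + sum ls) (sym (m+[n∸m]≡n ℓ≤q)) q<))
    in y , ℓ′ , t , there yℓ′∈ ,
       trans y+t≡ (trans (+-assoc x ℓ (q ∸ ℓ)) (cong (x +_) (m+[n∸m]≡n ℓ≤q))) , t< ,
       trans (locate-≥ (f (x , ℓ)) _ q (subst (λ z → ¬ q < z) (sym (len-f (x , ℓ))) q≮ℓ))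
             (trans (cong (λ z → locate (map f (spans (x + ℓ) ls)) (q ∸ z)) (len-f (x , ℓ))) loc)

module Construction {A : Set} {n : ℕ} (S : Vec A n) (L : ℕ) (P : List Phrase)
                    (valid : IsParse S L P) (α : ℕ) (1≤α : 1 ≤ α) where
  open Split α 1≤α

  sum-P : sum (map len P) ≡ n
  sum-P = proj₁ valid

  good-P : All (GoodPhrase S L) (positioned 0 P)
  good-P = proj₁ (proj₂ valid)

  height-P : ∀ q → q < n → ∃ λ h → Height P q h
  height-P = proj₂ (proj₂ valid)

  lengths : List ℕ
  lengths = concatMap (pieces ∘ len) P

  cuts : List (ℕ × ℕ)
  cuts = spans 0 lengths

  sum-lengths : sum lengths ≡ n
  sum-lengths = trans (sum-concatMap (pieces ∘ len) (sum-pieces ∘ len) P) sum-P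

  cut-origin : ∀ {c} → c ∈ cuts → ∃₂ λ x B → (x , B) ∈ positioned 0 P × Tapered 0 x (len B) c
  cut-origin c∈ =
    let x , B , xB∈ , c∈B = ∈-spans-concatMap (pieces ∘ len) (sum-pieces ∘ len) 0 P c∈
    in x , B , xB∈ , All.lookup (tapered-pieces x (len B)) c∈B

  Respects : ℕ → ℕ → ℕ × ℕ → Set
  Respects s ℓ (y , m) = Overlap s ℓ y m → m ≤ α * ℓ

  overlap? : ∀ s ℓ y m → Dec (Overlap s ℓ y m)
  overlap? s ℓ y m = s <? y + m ×-dec y <? s + ℓ

  respects? : ∀ s ℓ c → Dec (Respects s ℓ c)
  respects? s ℓ (y , m) = overlap? s ℓ y m →-dec m ≤? α * ℓ

  Fits : ℕ → ℕ → Set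
  Fits s ℓ = All (Respects s ℓ) cuts

  fits? : ∀ s ℓ → Dec (Fits s ℓ)
  fits? s ℓ = All.all? (respects? s ℓ) cuts

  Inside : ℕ → ℕ → Set
  Inside y ℓ = ∃₂ λ x B → (x , B) ∈ positioned 0 P × ∃ λ k → y ≡ x + k × k + ℓ ≤ len B

  unfit-inside : ∀ {s ℓ} → ¬ Fits s ℓ → Inside s ℓ
  unfit-inside {s} {ℓ} unfit with find (¬All⇒Any¬ (respects? s ℓ) cuts unfit)
  ... | (y , m) , ym∈ , ¬respects with cut-origin ym∈
  ... | x , B , xB∈ , o , c , refl , o+m+c≡ , _ , m≤o , m≤c =
    x , B , xB∈ , s ∸ x , sym (m+[n∸m]≡n x≤s) ,
    +-cancelˡ-≤ x _ _ (subst₂ _≤_ (trans (cong (_+ ℓ) (sym (m+[n∸m]≡n x≤s))) (+-assoc x (s ∸ x) ℓ)) end≡ s+ℓ≤)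
    where
    overlapping : Overlap s ℓ (x + o) m
    overlapping with overlap? s ℓ (x + o) m
    ... | yes ov = ov
    ... | no ¬ov = contradiction (λ ov → contradiction ov ¬ov) ¬respects
    within = overlap⇒within α overlapping (≰⇒> (λ m≤ → ¬respects (λ _ → m≤))) m≤o m≤c
    x≤s = proj₁ within
    s+ℓ≤ = proj₂ within
    end≡ : x + o + m + c ≡ x + len B
    end≡ = trans (reassoc x o m c) (cong (x +_) o+m+c≡)
      where
      reassoc : ∀ x o m c → x + o + m + c ≡ x + (o + m + c)
      reassoc = solve-∀

  Precursor : ℕ → ℕ → ℕ → Set
  Precursor s y ℓ =
    s + ℓ ≤ n ×
    (∀ t → t < ℓ → charAt S (s + t) ≡ charAt S (y + t)) ×
    (∀ t {h} → t < ℓ → Height P (y + t) h → ∃ λ h′ → h′ < h × Height P (s + t) h′)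

  precursor-trans : ∀ {s′ s y ℓ} → Precursor s′ s ℓ → Precursor s y ℓ → Precursor s′ y ℓ
  precursor-trans (s′+ℓ≤ , chars′ , desc′) (_ , chars , desc) =
    s′+ℓ≤ , (λ t t< → trans (chars′ t t<) (chars t t<)) , λ t t< d →
      let h′ , h′< , d′ = desc t t< d
          h″ , h″< , d″ = desc′ t t< d′
      in h″ , <-trans h″< h′< , d″

  +-offset-< : ∀ {k t ℓ m} → t < ℓ → k + ℓ ≤ m → k + t < m
  +-offset-< {k} t<ℓ k+ℓ≤m = <-≤-trans (+-monoʳ-< k t<ℓ) k+ℓ≤m

  inside-explicit : ∀ {y ℓ k m} → 1 ≤ ℓ → Inside y ℓ → locate P y ≡ just (k , explicit m) → ℓ ≤ L
  inside-explicit {ℓ = ℓ} 1≤ℓ (x , B , xB∈ , k , refl , k+ℓ≤) e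
    with trans (sym e) (locate-positioned P xB∈ k (<-≤-trans (m<m+n k 1≤ℓ) k+ℓ≤))
  ... | refl = ≤-trans (≤-trans (m≤n+m ℓ k) k+ℓ≤) (proj₂ (All.lookup good-P xB∈))

  inside-copy : ∀ {y ℓ k m p} → 1 ≤ ℓ → Inside y ℓ → locate P y ≡ just (k , copy m p) → Precursor (p + k) y ℓ
  inside-copy {ℓ = ℓ} {p = p} 1≤ℓ (x , B , xB∈ , k , refl , k+ℓ≤) e
    with trans (sym e) (locate-positioned P xB∈ k (<-≤-trans (m<m+n k 1≤ℓ) k+ℓ≤))
  ... | refl with All.lookup good-P xB∈
  ... | _ , p+m≤n , chars = source≤n , chars′ , descend
    where
    source≤n : p + k + ℓ ≤ n
    source≤n = ≤-trans (≤-reflexive (+-assoc p k ℓ)) (≤-trans (+-monoʳ-≤ p k+ℓ≤) p+m≤n)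
    chars′ : ∀ t → t < ℓ → charAt S (p + k + t) ≡ charAt S (x + k + t)
    chars′ t t< = begin
      charAt S (p + k + t)    ≡⟨ cong (charAt S) (+-assoc p k t) ⟩
      charAt S (p + (k + t))  ≡⟨ chars (k + t) (+-offset-< t< k+ℓ≤) ⟩
      charAt S (x + (k + t))  ≡⟨ cong (charAt S) (+-assoc x k t) ⟨
      charAt S (x + k + t)    ∎
      where open ≡-Reasoning
    descend : ∀ t {h} → t < ℓ → Height P (x + k + t) h → ∃ λ h′ → h′ < h × Height P (p + k + t) h′
    descend t t< d with height-copy loc d
      where
      loc : locate P (x + k + t) ≡ just (k + t , copy _ p)
      loc = trans (cong (locate P) (+-assoc x k t)) (locate-positioned P xB∈ (k + t) (+-offset-< t< k+ℓ≤))
    ... | h′ , refl , d′ = h′ , ≤-refl , subst (λ z → Height P z h′) (sym (+-assoc p k t)) d′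

  resolve : ∀ {y h} → ℕ → Height P y h → Phrase
  resolve ℓ (here _) = explicit ℓ
  resolve ℓ (step {k = k} {p = p} _ d) with fits? (p + k) ℓ
  ... | yes _ = copy ℓ (p + k)
  ... | no _  = resolve ℓ d

  len-resolve : ∀ {y h} ℓ (d : Height P y h) → len (resolve ℓ d) ≡ ℓ
  len-resolve ℓ (here _) = refl
  len-resolve ℓ (step {k = k} {p = p} _ d) with fits? (p + k) ℓ
  ... | yes _ = refl
  ... | no _  = len-resolve ℓ d

  Resolution : ℕ → ℕ → Phrase → Set
  Resolution y ℓ b = (b ≡ explicit ℓ × ℓ ≤ L) ⊎ ∃ λ s → b ≡ copy ℓ s × Fits s ℓ × Precursor s y ℓ

  resolve-spec : ∀ {y h ℓ} → 1 ≤ ℓ → Inside y ℓ → (d : Height P y h) → Resolution y ℓ (resolve ℓ d)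
  resolve-spec 1≤ℓ inside (here e) = inj₁ (refl , inside-explicit 1≤ℓ inside e)
  resolve-spec {ℓ = ℓ} 1≤ℓ inside (step {k = k} {p = p} e d) with fits? (p + k) ℓ
  ... | yes fits = inj₂ (p + k , refl , fits , inside-copy 1≤ℓ inside e)
  ... | no unfit with resolve-spec 1≤ℓ (unfit-inside unfit) d
  ...   | inj₁ explicit≤L           = inj₁ explicit≤L
  ...   | inj₂ (s , eq , fits , prec) = inj₂ (s , eq , fits , precursor-trans prec (inside-copy 1≤ℓ inside e))

  cut-inside : ∀ {y ℓ} → (y , ℓ) ∈ cuts → 1 ≤ ℓ × Inside y ℓ
  cut-inside yℓ∈ with cut-origin yℓ∈
  ... | x , B , xB∈ , o , c , y≡ , o+ℓ+c≡ , 1≤ℓ , _ =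
    1≤ℓ , x , B , xB∈ , o , y≡ , subst (_ ≤_) o+ℓ+c≡ (m≤m+n _ c)

  inside-bound : ∀ {y ℓ} → Inside y ℓ → y + ℓ ≤ n
  inside-bound {ℓ = ℓ} (x , B , xB∈ , k , refl , k+ℓ≤) = begin
    x + k + ℓ    ≡⟨ +-assoc x k ℓ ⟩
    x + (k + ℓ)  ≤⟨ +-monoʳ-≤ x k+ℓ≤ ⟩
    x + len B    ≤⟨ positioned-bound 0 P xB∈ ⟩
    sum (map len P) ≡⟨ sum-P ⟩
    n            ∎
    where open ≤-Reasoning

  -- The guard y < n holds for every cut; the fallback is never used.
  rephrase : ℕ × ℕ → Phrase
  rephrase (y , ℓ) with y <? n
  ... | yes y<n = resolve ℓ (proj₂ (height-P y y<n))
  ... | no _    = explicit ℓ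

  len-rephrase : ∀ c → len (rephrase c) ≡ proj₂ c
  len-rephrase (y , ℓ) with y <? n
  ... | yes y<n = len-resolve ℓ (proj₂ (height-P y y<n))
  ... | no _    = refl

  rephrase-spec : ∀ {y ℓ} → (y , ℓ) ∈ cuts → 1 ≤ ℓ × Resolution y ℓ (rephrase (y , ℓ))
  rephrase-spec {y} yℓ∈ with cut-inside yℓ∈ | y <? n
  ... | 1≤ℓ , inside | yes y<n = 1≤ℓ , resolve-spec 1≤ℓ inside (proj₂ (height-P y y<n))
  ... | 1≤ℓ , inside | no y≮n  = contradiction (<-≤-trans (m<m+n y 1≤ℓ) (inside-bound inside)) y≮n

  P′ : List Phrase
  P′ = map rephrase cuts

  open Tiling rephrase len-rephrase

  ∈-positioned-P′ : ∀ {y b} → (y , b) ∈ positioned 0 P′ → ∃ λ ℓ → (y , ℓ) ∈ cuts × b ≡ rephrase (y , ℓ)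
  ∈-positioned-P′ yb∈ rewrite positioned-tiling 0 lengths with ∈-map⁻ < proj₁ , rephrase > yb∈
  ... | (_ , ℓ) , yℓ∈ , refl = ℓ , yℓ∈ , refl

  good-P′ : All (GoodPhrase S L) (positioned 0 P′)
  good-P′ = All.tabulate λ {(y , b)} yb∈ → good (∈-positioned-P′ yb∈)
    where
    good : ∀ {y b} → (∃ λ ℓ → (y , ℓ) ∈ cuts × b ≡ rephrase (y , ℓ)) → GoodPhrase S L (y , b)
    good (ℓ , yℓ∈ , refl) with rephrase-spec yℓ∈
    ... | 1≤ℓ , inj₁ (eq , ℓ≤L) rewrite eq = 1≤ℓ , ℓ≤L
    ... | 1≤ℓ , inj₂ (s , eq , _ , s+ℓ≤n , chars , _) rewrite eq = 1≤ℓ , s+ℓ≤n , chars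

  copy-fits : ∀ {x ℓ p} → (x , copy ℓ p) ∈ positioned 0 P′ → Fits p ℓ
  copy-fits xc∈ with ∈-positioned-P′ xc∈
  ... | ℓ , xℓ∈ , eq with rephrase-spec xℓ∈
  ...   | _ , inj₁ (eq′ , _) with trans eq eq′
  ...     | ()
  copy-fits xc∈ | ℓ , xℓ∈ , eq | _ , inj₂ (s , eq′ , fits , _) with trans eq eq′
  ...     | refl = fits

  contracting : Contracting α P′
  contracting b xc∈ yb∈ overlapping with ∈-positioned-P′ yb∈
  ... | m , ym∈ , refl = subst (_≤ α * _) (sym len≡m) (respects (subst (Overlap _ _ _) len≡m overlapping))
    where
    len≡m = len-rephrase (_ , m)
    respects = All.lookup (copy-fits xc∈) ym∈

  height-in-P′ : ∀ h q → q < n → Height P q h → ∃ λ h′ → h′ ≤ h × Height P′ q h′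
  height-in-P′ = <-rec Lowers descend
    where
    Lowers : ℕ → Set
    Lowers h = ∀ q → q < n → Height P q h → ∃ λ h′ → h′ ≤ h × Height P′ q h′
    descend : ∀ h → (∀ {h₀} → h₀ < h → Lowers h₀) → Lowers h
    descend h rec q q<n d with locate-tiling 0 lengths q (subst (q <_) (sym sum-lengths) q<n)
    ... | y , ℓ , t , yℓ∈ , refl , t<ℓ , loc with rephrase-spec yℓ∈
    ... | _ , inj₁ (eq , _) = 0 , z≤n , here (trans loc (cong (λ b → just (t , b)) eq))
    ... | _ , inj₂ (s , eq , _ , s+ℓ≤n , _ , desc) with desc t t<ℓ d
    ... | h″ , h″<h , d″ with rec h″<h (s + t) (<-≤-trans (+-monoʳ-< s t<ℓ) s+ℓ≤n) d″
    ... | h‴ , h‴≤h″ , d‴ = suc h‴ , ≤-trans (s≤s h‴≤h″) h″<h ,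
                            step (trans loc (cong (λ b → just (t , b)) eq)) d‴

  isParse-P′ : IsParse S L P′
  isParse-P′ = trans (cong sum (map-len-tiling 0 lengths)) sum-lengths , good-P′ , λ q q<n →
    let h , d = height-P q q<n
        h′ , _ , d′ = height-in-P′ h q q<n d
    in h′ , d′

  height-P′-≤ : ∀ q h h′ → q < n → Height P q h → Height P′ q h′ → h′ ≤ h
  height-P′-≤ q h h′ q<n d d′ =
    let h″ , h″≤h , d″ = height-in-P′ h q q<n d in subst (_≤ h) (height-unique d″ d′) h″≤h

  length-P′ : length P′ ≡ length lengths
  length-P′ = trans (sym (length-map len P′)) (cong length (map-len-tiling 0 lengths))

  length-P′-≤ : ∀ k → n ≤ length P * α ^ k → length P′ ≤ 5 * length P * (1 ⊔ k)
  length-P′-≤ k n≤ = begin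
    length P′                ≤⟨ *-cancelˡ-≤ (α ^ k) {{m^n≢0 α k {{>-nonZero 1≤α}}}} scaled ⟩
    b * (1 + 2 * suc k)      ≤⟨ *-monoʳ-≤ b (1+2*[1+k]≤5*[1⊔k] k) ⟩
    b * (5 * (1 ⊔ k))        ≡⟨ reassoc b 5 (1 ⊔ k) ⟩
    5 * b * (1 ⊔ k)          ∎
    where
    open ≤-Reasoning
    b = length P
    K = α ^ k
    reassoc : ∀ x y z → x * (y * z) ≡ y * x * z
    reassoc = solve-∀
    regroup : ∀ b K k → b * K + b * (2 * suc k * K) ≡ K * (b * (1 + 2 * suc k))
    regroup = solve-∀
    scaled : K * length P′ ≤ K * (b * (1 + 2 * suc k))
    scaled = begin
      K * length P′                     ≡⟨ cong (K *_) length-P′ ⟩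
      K * length lengths                ≤⟨ length-concatMap-≤ (pieces ∘ len) len K (2 * suc k * K)
                                                              (length-pieces-≤ k ∘ len) P ⟩
      sum (map len P) + b * (2 * suc k * K) ≡⟨ cong (_+ b * (2 * suc k * K)) sum-P ⟩
      n + b * (2 * suc k * K)           ≤⟨ +-monoˡ-≤ _ n≤ ⟩
      b * K + b * (2 * suc k * K)       ≡⟨ regroup b K k ⟩
      K * (b * (1 + 2 * suc k))         ∎

lemma12 : ∃ λ (C : ℕ) →
    ∀ {A : Set} {n : ℕ} (S : Vec A n) (L : ℕ) (P : List Phrase) →
    IsParse S L P →
    (α : ℕ) → 1 < α →
    Σ (List Phrase) λ P′ →
      IsParse S L P′ ×
      Contracting α P′ ×
      (∀ k → n ≤ length P * α ^ k → length P′ ≤ C * length P * (1 ⊔ k)) ×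
      (∀ q h h′ → q < n → Height P q h → Height P′ q h′ → h′ ≤ h)
lemma12 = 5 , λ S L P valid α 1<α →
  let open Construction S L P valid α (<⇒≤ 1<α)
  in P′ , isParse-P′ , contracting , length-P′-≤ , height-P′-≤
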